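{- Let $k>1$ be an integer, let $a_1,\ldots,a_k\in\mathbb{Z}$ and $n_1,\ldots,n_k\in\mathbb{Z}^+$, and let $w(x)=|\{1\leqslant s\leqslant k:\ x\equiv a_s\ (\mathrm{mod}\ n_s)\}|$ for $x\in\mathbb{Z}$. Call a modulus $n_t$ maximal with respect to divisibility if there is no $s\in\{1,\ldots,k\}$ with $n_t\mid n_s$ and $n_s\neq n_t$. Suppose that the moduli maximal with respect to divisibility are distinct, i.e., whenever $n_t$ is maximal with respect to divisibility and $s\neq t$, we have $n_s\neq n_t$. Then the set $w(\mathbb{Z})=\{w(x):x\in\mathbb{Z}\}$ is not contained in any residue class $\{y\in\mathbb{Z}: y\equiv a\ (\mathrm{mod}\ m)\}$ with $a\in\mathbb{Z}$ and $m\in\mathbb{Z}^+$, $m>1$. Equivalently, for every prime $p$ there is $x\in\mathbb{Z}$ with $w(x)\not\equiv w(0)\ (\mathrm{mod}\ p)$; in particular, the values $w(x)$, $x\in\mathbb{Z}$, do not all have the same parity. -}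

module Defs where

open import Data.Nat as ℕ using (ℕ)
open import Data.Nat.Divisibility as ℕD using ()
open import Data.Integer using (ℤ; +_; _-_; ∣_∣)
open import Data.Integer.Divisibility using (_∣_)
open import Data.Fin using (Fin)
open import Data.List using (List; length; filter; allFin)
open import Relation.Nullary using (Dec)
open import Relation.Binary.PropositionalEquality as P using ()

_≡_[mod_] : ℤ → ℤ → ℕ → Set
x ≡ y [mod m ] = (+ m) ∣ (x - y)

congruent? : (x y : ℤ) (m : ℕ) → Dec (x ≡ y [mod m ])
congruent? x y m = ℕD._∣?_ m ∣ x - y ∣

w : {k : ℕ} → (Fin k → ℤ) → (Fin k → ℕ) → ℤ → ℕ
w {k} a n x = length (filter (λ s → congruent? x (a s) (n s)) (allFin k))

MaximalModulus : {k : ℕ} → (Fin k → ℕ) → Fin k → Set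
MaximalModulus {k} n t = ∀ (s : Fin k) → n t ℕD.∣ n s → n s P.≡ n t

-- Take t with n_t largest.  By hypothesis N = n_t divides no other modulus, so
-- w(y) - b = 𝟙[y ≡ a_t (mod N)] + Σ e_s 𝟙[y ≡ a_s (mod n_s)] with N ∤ n_s for all
-- the other classes (-b being the weight of the class 0 mod 1).  No such combination
-- is ≡ 0 (mod m) for all y.  Induct on the prime factorisation of N: for a prime
-- q ∣ N choose d with q ∤ d that is a multiple of every modulus prime to q, and
-- subtract the values at c + d + qy from those at c + qy.  Classes of modulus prime
-- to q cancel; a class of modulus n'q becomes a class of modulus n' in y (or vanishes);
-- the main class becomes 𝟙[y ≡ 0 (mod N/q)], its shifted copy vanishes since q ∤ d.
-- For N = 1 no other class is left and the combination is the constant 1.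
module Submission where

open import Defs
open import Data.Nat using (ℕ; _<_; NonZero)
open import Data.Integer using (ℤ; +_)
open import Data.Fin using (Fin)
open import Relation.Binary.PropositionalEquality using (_≡_; _≢_)
open import Relation.Nullary using (¬_)

open import Algebra.Properties.CommutativeSemigroup using (x∙yz≈y∙xz)
open import Data.Bool using (if_then_else_)
open import Data.Fin using (zero; suc; punchIn)
open import Data.Fin.Properties using (punchInᵢ≢i)
open import Data.Integer using (_+_; _-_; _*_; -_; 0ℤ; 1ℤ)
open import Data.Integer.Divisibility.Signed
  using (_∣_; _∣?_; divides; ∣ᵤ⇒∣; ∣⇒∣ᵤ; ∣-refl; ∣-trans; ∣m+n∣n⇒∣m; ∣m∣n⇒∣m+n; ∣m∣n⇒∣m-n;
         ∣m⇒∣-m; ∣m⇒∣m*n; *-monoˡ-∣; *-cancelʳ-∣)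
open import Data.Integer.Properties
  using (+-identityˡ; +-identityʳ; +-assoc; +-inverseʳ; *-identityˡ; *-zeroʳ; neg-distribˡ-*; pos-*;
         +-commutativeSemigroup)
open import Data.Integer.Tactic.RingSolver using (solve-∀)
open import Data.List using (List; []; _∷_; _++_; map; concatMap; filter; tabulate; allFin; length)
open import Data.List.Extrema.Nat using (argmax; f[xs]≤f[argmax])
open import Data.List.Membership.Propositional.Properties using (∈-filter⁺; ∈-allFin)
open import Data.List.Properties using (map-tabulate)
open import Data.List.Relation.Unary.All as All using (All; []; _∷_)
open import Data.List.Relation.Unary.All.Properties
  using (++⁺; concat⁺; map⁺; map⁻; all-filter; tabulate⁺)
import Data.Nat as ℕ
import Data.Nat.Divisibility as ℕ
open import Data.Nat.ListAction using (product)
open import Data.Nat.ListAction.Properties using (∈⇒∣product)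
open import Data.Nat.Primality using (Prime; ¬prime[1]; euclidsLemma; prime⇒nonZero)
open import Data.Nat.Primality.Factorisation using (factorise)
open import Data.Nat.Properties as ℕP using (≤-antisym; <-irrefl)
open import Data.Product using (∃; _×_; _,_)
open import Data.Sum using ([_,_]′)
open import Function using (id; _∘_; mk⇔)
open import Relation.Binary.PropositionalEquality
  using (refl; sym; trans; cong; cong₂; subst; subst₂; module ≡-Reasoning)
open import Relation.Nullary using (does; yes; no; ¬?)
open import Relation.Nullary.Decidable using (dec-true; dec-false; does-⇔)

prime∤product : ∀ {p ns} → Prime p → All (λ n → ¬ p ℕ.∣ n) ns → ¬ p ℕ.∣ product ns
prime∤product p-prime []           p∣1    = ¬prime[1] (subst Prime (ℕ.∣1⇒≡1 p∣1) p-prime)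
prime∤product p-prime (p∤n ∷ p∤ns) p∣n*ns =
  [ p∤n , prime∤product p-prime p∤ns ]′ (euclidsLemma _ _ p-prime p∣n*ns)

prime-free-common-multiple : ∀ {p} → Prime p → (ns : List ℕ) →
                             ∃ λ d → ¬ p ℕ.∣ d × All (λ n → ¬ p ℕ.∣ n → n ℕ.∣ d) ns
prime-free-common-multiple {p} p-prime ns =
  product (filter p∤? ns) ,
  prime∤product p-prime (all-filter p∤? ns) ,
  All.tabulate (λ n∈ns p∤n → ∈⇒∣product (∈-filter⁺ p∤? n∈ns p∤n))
  where
  p∤? = λ n → ¬? (p ℕ.∣? n)

+-minus-interchange : ∀ a b c d → (a + b) - (c + d) ≡ (a - c) + (b - d)
+-minus-interchange = solve-∀

-- Opaque, so that unification can recover x, a and n from 𝟙[ x ≡ a mod n ].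
opaque
  𝟙[_≡_mod_] : ℤ → ℤ → ℕ → ℤ
  𝟙[ x ≡ a mod n ] = if does (congruent? x a n) then 1ℤ else 0ℤ

module _ {x a : ℤ} {n : ℕ} where
  opaque
    unfolding 𝟙[_≡_mod_]

    𝟙-yes : + n ∣ x - a → 𝟙[ x ≡ a mod n ] ≡ 1ℤ
    𝟙-yes n∣x-a = cong (if_then 1ℤ else 0ℤ) (dec-true (congruent? x a n) (∣⇒∣ᵤ n∣x-a))

    𝟙-no : ¬ (+ n ∣ x - a) → 𝟙[ x ≡ a mod n ] ≡ 0ℤ
    𝟙-no n∤x-a = cong (if_then 1ℤ else 0ℤ) (dec-false (congruent? x a n) (n∤x-a ∘ ∣ᵤ⇒∣))

    𝟙-cong : ∀ {y b n′} → (+ n ∣ x - a → + n′ ∣ y - b) → (+ n′ ∣ y - b → + n ∣ x - a) →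
             𝟙[ x ≡ a mod n ] ≡ 𝟙[ y ≡ b mod n′ ]
    𝟙-cong {y} {b} {n′} to from = cong (if_then 1ℤ else 0ℤ)
      (does-⇔ (mk⇔ (∣⇒∣ᵤ ∘ to ∘ ∣ᵤ⇒∣) (∣⇒∣ᵤ ∘ from ∘ ∣ᵤ⇒∣)) (congruent? x a n) (congruent? y b n′))

𝟙-mod-1 : ∀ x a → 𝟙[ x ≡ a mod 1 ] ≡ 1ℤ
𝟙-mod-1 x a = 𝟙-yes (∣ᵤ⇒∣ (ℕ.1∣ _))

𝟙-periodic : ∀ x a {n d} → n ℕ.∣ d → 𝟙[ x + + d ≡ a mod n ] ≡ 𝟙[ x ≡ a mod n ]
𝟙-periodic x a {n} {d} n∣d = 𝟙-cong
  (λ n∣x+d-a → ∣m+n∣n⇒∣m (subst (+ n ∣_) (shift x a (+ d)) n∣x+d-a) (∣ᵤ⇒∣ n∣d))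
  (λ n∣x-a → subst (+ n ∣_) (sym (shift x a (+ d))) (∣m∣n⇒∣m+n n∣x-a (∣ᵤ⇒∣ n∣d)))
  where
  shift : ∀ x a d → x + d - a ≡ (x - a) + d
  shift = solve-∀

module _ (q : ℕ) .{{_ : NonZero q}} where

  𝟙-affine : ∀ c a k n y → a - c ≡ k * + q → 𝟙[ c + + q * y ≡ a mod n ℕ.* q ] ≡ 𝟙[ y ≡ k mod n ]
  𝟙-affine c a k n y a-c≡kq = 𝟙-cong
    (λ nq∣ → *-cancelʳ-∣ (+ q) (subst₂ _∣_ (pos-* n q) rescale nq∣))
    (λ n∣ → subst₂ _∣_ (sym (pos-* n q)) (sym rescale) (*-monoˡ-∣ (+ q) n∣))
    where
    open ≡-Reasoning
    take-out : ∀ c q y a → c + q * y - a ≡ q * y - (a - c)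
    take-out = solve-∀
    factor : ∀ q y k → q * y - k * q ≡ (y - k) * q
    factor = solve-∀
    rescale : c + + q * y - a ≡ (y - k) * + q
    rescale = begin
      c + + q * y - a      ≡⟨ take-out c (+ q) y a ⟩
      + q * y - (a - c)    ≡⟨ cong (λ z → + q * y - z) a-c≡kq ⟩
      + q * y - k * + q    ≡⟨ factor (+ q) y k ⟩
      (y - k) * + q        ∎

  𝟙-affine-disjoint : ∀ c a n y → ¬ (+ q ∣ a - c) → 𝟙[ c + + q * y ≡ a mod n ℕ.* q ] ≡ 0ℤ
  𝟙-affine-disjoint c a n y q∤a-c = 𝟙-no λ nq∣ → q∤a-c (subst (+ q ∣_) (recover c (+ q) y a)
    (∣m∣n⇒∣m-n (∣m⇒∣m*n y ∣-refl) (∣-trans (∣ᵤ⇒∣ (ℕ.n∣m*n n)) nq∣)))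
    where
    recover : ∀ c q y a → q * y - (c + q * y - a) ≡ a - c
    recover = solve-∀

infix 6 _·[_mod_]

record WeightedClass : Set where
  constructor _·[_mod_]
  field
    weight  : ℤ
    residue : ℤ
    modulus : ℕ

open WeightedClass

⟨_⟩ : WeightedClass → ℤ → ℤ
⟨ e ·[ a mod n ] ⟩ x = e * 𝟙[ x ≡ a mod n ]

⟦_⟧ : List WeightedClass → ℤ → ℤ
⟦ [] ⟧     x = 0ℤ
⟦ C ∷ Cs ⟧ x = ⟨ C ⟩ x + ⟦ Cs ⟧ x

infix 4 _∤-moduli_

_∤-moduli_ : ℕ → List WeightedClass → Set
N ∤-moduli Cs = All (λ C → ¬ N ℕ.∣ modulus C) Cs

⟦⟧-++ : ∀ Cs Ds x → ⟦ Cs ++ Ds ⟧ x ≡ ⟦ Cs ⟧ x + ⟦ Ds ⟧ x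
⟦⟧-++ []       Ds x = sym (+-identityˡ _)
⟦⟧-++ (C ∷ Cs) Ds x = trans (cong (_+_ (⟨ C ⟩ x)) (⟦⟧-++ Cs Ds x)) (sym (+-assoc (⟨ C ⟩ x) _ _))

⟦tabulate⟧-punchIn : ∀ {k} (f : Fin (ℕ.suc k) → WeightedClass) t x →
                     ⟦ tabulate f ⟧ x ≡ ⟨ f t ⟩ x + ⟦ tabulate (f ∘ punchIn t) ⟧ x
⟦tabulate⟧-punchIn               f zero    x = refl
⟦tabulate⟧-punchIn {k = ℕ.suc k} f (suc t) x = begin
  ⟨ f zero ⟩ x + ⟦ tabulate (f ∘ suc) ⟧ x
    ≡⟨ cong (_+_ (⟨ f zero ⟩ x)) (⟦tabulate⟧-punchIn (f ∘ suc) t x) ⟩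
  ⟨ f zero ⟩ x + (⟨ f (suc t) ⟩ x + R)
    ≡⟨ x∙yz≈y∙xz +-commutativeSemigroup (⟨ f zero ⟩ x) (⟨ f (suc t) ⟩ x) R ⟩
  ⟨ f (suc t) ⟩ x + (⟨ f zero ⟩ x + R) ∎
  where
  open ≡-Reasoning
  R = ⟦ tabulate (f ∘ suc ∘ punchIn t) ⟧ x

module Difference (q : ℕ) .{{_ : NonZero q}} (c : ℤ) (d : ℕ) where

  pullback : ℤ → WeightedClass → List WeightedClass
  pullback c′ (e ·[ a mod n ]) with + q ∣? (a - c′)
  ... | yes (divides k _) = e ·[ k mod n ] ∷ []
  ... | no _              = []

  Δ₁ : WeightedClass → List WeightedClass
  Δ₁ (e ·[ a mod n ]) with q ℕ.∣? n
  ... | yes (ℕ.divides n′ _) = pullback c (e ·[ a mod n′ ]) ++ pullback (c + + d) (- e ·[ a mod n′ ])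
  ... | no _                 = []

  Δ : List WeightedClass → List WeightedClass
  Δ = concatMap Δ₁

  pullback-⟦⟧ : ∀ c′ e a n y →
                ⟦ pullback c′ (e ·[ a mod n ]) ⟧ y ≡ ⟨ e ·[ a mod n ℕ.* q ] ⟩ (c′ + + q * y)
  pullback-⟦⟧ c′ e a n y with + q ∣? (a - c′)
  ... | yes (divides k a-c′≡kq) =
    trans (+-identityʳ _) (cong (e *_) (sym (𝟙-affine q c′ a k n y a-c′≡kq)))
  ... | no q∤a-c′ =
    sym (trans (cong (e *_) (𝟙-affine-disjoint q c′ a n y q∤a-c′)) (*-zeroʳ e))

  pullback-modulus : ∀ c′ e a n → All (λ C → modulus C ≡ n) (pullback c′ (e ·[ a mod n ]))
  pullback-modulus c′ e a n with + q ∣? (a - c′)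
  ... | yes _ = refl ∷ []
  ... | no _  = []

  Δ₁-modulus : ∀ C → All (λ C′ → modulus C′ ℕ.* q ≡ modulus C) (Δ₁ C)
  Δ₁-modulus (e ·[ a mod n ]) with q ℕ.∣? n
  ... | yes (ℕ.divides n′ refl) =
    All.map (cong (ℕ._* q)) (++⁺ (pullback-modulus c e a n′) (pullback-modulus (c + + d) (- e) a n′))
  ... | no _ = []

  Δ-∤-moduli : ∀ N Cs → N ℕ.* q ∤-moduli Cs → N ∤-moduli Δ Cs
  Δ-∤-moduli N Cs Nq∤Cs = concat⁺ (map⁺ (All.map Δ₁-∤-moduli Nq∤Cs))
    where
    Δ₁-∤-moduli : ∀ {C} → ¬ N ℕ.* q ℕ.∣ modulus C → N ∤-moduli Δ₁ C
    Δ₁-∤-moduli {C} Nq∤C =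
      All.map (λ eq N∣ → Nq∤C (subst (N ℕ.* q ℕ.∣_) eq (ℕ.*-monoˡ-∣ q N∣))) (Δ₁-modulus C)

  Δ₁-⟦⟧ : ∀ C → (¬ q ℕ.∣ modulus C → modulus C ℕ.∣ d) →
          ∀ y → ⟨ C ⟩ (c + + q * y) - ⟨ C ⟩ (c + + d + + q * y) ≡ ⟦ Δ₁ C ⟧ y
  Δ₁-⟦⟧ (e ·[ a mod n ]) n∣d y with q ℕ.∣? n
  ... | no q∤n = begin
    e * 𝟙[ x ≡ a mod n ] - e * 𝟙[ c + + d + + q * y ≡ a mod n ]
      ≡⟨ cong (λ z → e * 𝟙[ x ≡ a mod n ] - e * 𝟙[ z ≡ a mod n ]) (swap c (+ d) (+ q * y)) ⟩
    e * 𝟙[ x ≡ a mod n ] - e * 𝟙[ x + + d ≡ a mod n ]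
      ≡⟨ cong (λ z → e * 𝟙[ x ≡ a mod n ] - e * z) (𝟙-periodic x a (n∣d q∤n)) ⟩
    e * 𝟙[ x ≡ a mod n ] - e * 𝟙[ x ≡ a mod n ]
      ≡⟨ +-inverseʳ (e * 𝟙[ x ≡ a mod n ]) ⟩
    0ℤ ∎
    where
    open ≡-Reasoning
    x = c + + q * y
    swap : ∀ c d z → c + d + z ≡ c + z + d
    swap = solve-∀
  ... | yes (ℕ.divides n′ refl) = begin
    C-at (c + + q * y) - C-at (c + + d + + q * y)
      ≡⟨ cong (_+_ (C-at (c + + q * y))) (neg-distribˡ-* e _) ⟩
    C-at (c + + q * y) + ⟨ - e ·[ a mod n′ ℕ.* q ] ⟩ (c + + d + + q * y)
      ≡⟨ sym (cong₂ _+_ (pullback-⟦⟧ c e a n′ y) (pullback-⟦⟧ (c + + d) (- e) a n′ y)) ⟩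
    ⟦ pullback c (e ·[ a mod n′ ]) ⟧ y + ⟦ pullback (c + + d) (- e ·[ a mod n′ ]) ⟧ y
      ≡⟨ sym (⟦⟧-++ (pullback c (e ·[ a mod n′ ])) _ y) ⟩
    ⟦ pullback c (e ·[ a mod n′ ]) ++ pullback (c + + d) (- e ·[ a mod n′ ]) ⟧ y ∎
    where
    open ≡-Reasoning
    C-at = ⟨ e ·[ a mod n′ ℕ.* q ] ⟩

  Δ-⟦⟧ : ∀ Cs → All (λ C → ¬ q ℕ.∣ modulus C → modulus C ℕ.∣ d) Cs →
         ∀ y → ⟦ Cs ⟧ (c + + q * y) - ⟦ Cs ⟧ (c + + d + + q * y) ≡ ⟦ Δ Cs ⟧ y
  Δ-⟦⟧ []       []       y = refl
  Δ-⟦⟧ (C ∷ Cs) (h ∷ hs) y = begin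
    (⟨ C ⟩ x₀ + ⟦ Cs ⟧ x₀) - (⟨ C ⟩ x₁ + ⟦ Cs ⟧ x₁)
      ≡⟨ +-minus-interchange (⟨ C ⟩ x₀) (⟦ Cs ⟧ x₀) (⟨ C ⟩ x₁) (⟦ Cs ⟧ x₁) ⟩
    (⟨ C ⟩ x₀ - ⟨ C ⟩ x₁) + (⟦ Cs ⟧ x₀ - ⟦ Cs ⟧ x₁)
      ≡⟨ cong₂ _+_ (Δ₁-⟦⟧ C h y) (Δ-⟦⟧ Cs hs y) ⟩
    ⟦ Δ₁ C ⟧ y + ⟦ Δ Cs ⟧ y
      ≡⟨ sym (⟦⟧-++ (Δ₁ C) (Δ Cs) y) ⟩
    ⟦ Δ₁ C ++ Δ Cs ⟧ y ∎
    where
    open ≡-Reasoning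
    x₀ = c + + q * y
    x₁ = c + + d + + q * y

  𝟙+⟦⟧-difference : ∀ N Cs → ¬ q ℕ.∣ d → All (λ C → ¬ q ℕ.∣ modulus C → modulus C ℕ.∣ d) Cs → ∀ y →
    (𝟙[ c + + q * y ≡ c mod N ℕ.* q ] + ⟦ Cs ⟧ (c + + q * y)) -
    (𝟙[ c + + d + + q * y ≡ c mod N ℕ.* q ] + ⟦ Cs ⟧ (c + + d + + q * y))
    ≡ 𝟙[ y ≡ 0ℤ mod N ] + ⟦ Δ Cs ⟧ y
  𝟙+⟦⟧-difference N Cs q∤d Cs-period y = begin
    (𝟙[ x₀ ≡ c mod N ℕ.* q ] + ⟦ Cs ⟧ x₀) - (𝟙[ x₁ ≡ c mod N ℕ.* q ] + ⟦ Cs ⟧ x₁)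
      ≡⟨ +-minus-interchange 𝟙[ x₀ ≡ c mod N ℕ.* q ] (⟦ Cs ⟧ x₀) 𝟙[ x₁ ≡ c mod N ℕ.* q ] (⟦ Cs ⟧ x₁) ⟩
    (𝟙[ x₀ ≡ c mod N ℕ.* q ] - 𝟙[ x₁ ≡ c mod N ℕ.* q ]) + (⟦ Cs ⟧ x₀ - ⟦ Cs ⟧ x₁)
      ≡⟨ cong₂ _+_ (cong₂ _-_ (𝟙-affine q c c 0ℤ N y (+-inverseʳ c))
                              (𝟙-affine-disjoint q (c + + d) c N y q∤-d))
                   (Δ-⟦⟧ Cs Cs-period y) ⟩
    (𝟙[ y ≡ 0ℤ mod N ] - 0ℤ) + ⟦ Δ Cs ⟧ y
      ≡⟨ cong (_+ ⟦ Δ Cs ⟧ y) (+-identityʳ 𝟙[ y ≡ 0ℤ mod N ]) ⟩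
    𝟙[ y ≡ 0ℤ mod N ] + ⟦ Δ Cs ⟧ y ∎
    where
    open ≡-Reasoning
    x₀ = c + + q * y
    x₁ = c + + d + + q * y
    negate-difference : ∀ c d → - (c - (c + d)) ≡ d
    negate-difference = solve-∀
    q∤-d : ¬ + q ∣ c - (c + + d)
    q∤-d q∣ = q∤d (∣⇒∣ᵤ (subst (+ q ∣_) (negate-difference c (+ d)) (∣m⇒∣-m q∣)))

module _ {m : ℕ} (1<m : 1 < m) where

  𝟙-uncancellable-∏ : ∀ {ps} → All Prime ps → ∀ c Cs → product ps ∤-moduli Cs →
                      ¬ (∀ y → + m ∣ 𝟙[ y ≡ c mod product ps ] + ⟦ Cs ⟧ y)
  𝟙-uncancellable-∏ [] c [] [] m∣ = <-irrefl (sym (ℕ.∣1⇒≡1 m∣1)) 1<m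
    where
    m∣1 : m ℕ.∣ 1
    m∣1 = ∣⇒∣ᵤ (subst (+ m ∣_) (trans (+-identityʳ _) (𝟙-mod-1 0ℤ c)) (m∣ 0ℤ))
  𝟙-uncancellable-∏ [] c (C ∷ Cs) (1∤C ∷ _) m∣ = 1∤C (ℕ.1∣ _)
  𝟙-uncancellable-∏ {q ∷ ps} (q-prime ∷ ps-prime) c Cs qN∤Cs m∣
    with prime-free-common-multiple q-prime (map modulus Cs)
  ... | d , q∤d , period rewrite ℕP.*-comm q (product ps) =
    𝟙-uncancellable-∏ ps-prime 0ℤ (Δ Cs) (Δ-∤-moduli (product ps) Cs qN∤Cs) λ y →
      subst (+ m ∣_) (𝟙+⟦⟧-difference (product ps) Cs q∤d (map⁻ period) y)
        (∣m∣n⇒∣m-n (m∣ (c + + q * y)) (m∣ (c + + d + + q * y)))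
    where
    instance _ = prime⇒nonZero q-prime
    open Difference q c d

  𝟙-uncancellable : ∀ N .{{_ : NonZero N}} c Cs → N ∤-moduli Cs →
                    ¬ (∀ y → + m ∣ 𝟙[ y ≡ c mod N ] + ⟦ Cs ⟧ y)
  𝟙-uncancellable N c Cs with factorise N
  ... | record { isFactorisation = refl ; factorsPrime = ps-prime } = 𝟙-uncancellable-∏ ps-prime c Cs

module _ {k : ℕ} (a : Fin k → ℤ) (n : Fin k → ℕ) where

  unitClass : Fin k → WeightedClass
  unitClass s = 1ℤ ·[ a s mod n s ]

  length-filter-congruent : ∀ y xs →
    + length (filter (λ s → congruent? y (a s) (n s)) xs) ≡ ⟦ map unitClass xs ⟧ y
  length-filter-congruent y []       = refl
  length-filter-congruent y (s ∷ xs) with congruent? y (a s) (n s)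
  ... | yes y≡a = cong₂ _+_ (sym (trans (*-identityˡ _) (𝟙-yes (∣ᵤ⇒∣ y≡a))))
                            (length-filter-congruent y xs)
  ... | no  y≢a = cong₂ _+_ (sym (trans (*-identityˡ _) (𝟙-no (y≢a ∘ ∣⇒∣ᵤ))))
                            (length-filter-congruent y xs)

module _ {k : ℕ} (a : Fin (ℕ.suc k) → ℤ) (n : Fin (ℕ.suc k) → ℕ) where

  w-b≡𝟙+⟦⟧ : ∀ t b y → + w a n y - b ≡
             𝟙[ y ≡ a t mod n t ] + ⟦ - b ·[ 0ℤ mod 1 ] ∷ tabulate (unitClass a n ∘ punchIn t) ⟧ y
  w-b≡𝟙+⟦⟧ t b y = begin
    + w a n y - b
      ≡⟨ cong (_- b) (length-filter-congruent a n y (allFin _)) ⟩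
    ⟦ map (unitClass a n) (allFin _) ⟧ y - b
      ≡⟨ cong (λ Cs → ⟦ Cs ⟧ y - b) (map-tabulate id (unitClass a n)) ⟩
    ⟦ tabulate (unitClass a n) ⟧ y - b
      ≡⟨ cong (_- b) (⟦tabulate⟧-punchIn (unitClass a n) t y) ⟩
    (1ℤ * 𝟙[ y ≡ a t mod n t ] + R) - b
      ≡⟨ move-constant 𝟙[ y ≡ a t mod n t ] R b ⟩
    𝟙[ y ≡ a t mod n t ] + (- b * 1ℤ + R)
      ≡⟨ cong (λ z → 𝟙[ y ≡ a t mod n t ] + (- b * z + R)) (sym (𝟙-mod-1 y 0ℤ)) ⟩
    𝟙[ y ≡ a t mod n t ] + (- b * 𝟙[ y ≡ 0ℤ mod 1 ] + R) ∎
    where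
    open ≡-Reasoning
    R = ⟦ tabulate (unitClass a n ∘ punchIn t) ⟧ y
    move-constant : ∀ x r b → (1ℤ * x + r) - b ≡ x + (- b * 1ℤ + r)
    move-constant = solve-∀

largest⇒maximal : ∀ {k} {n : Fin k → ℕ} → (∀ s → NonZero (n s)) →
                  ∀ t → (∀ s → n s ℕ.≤ n t) → MaximalModulus n t
largest⇒maximal nonZero t n≤n[t] s n[t]∣n[s] = ≤-antisym (n≤n[t] s) (ℕ.∣⇒≤ {{nonZero s}} n[t]∣n[s])

corollary1p2 : (k : ℕ) → 1 < k → (a : Fin k → ℤ) → (n : Fin k → ℕ) → (∀ s → NonZero (n s))
    → (∀ t → MaximalModulus n t → ∀ s → s ≢ t → n s ≢ n t)
    → ∀ (b : ℤ) (m : ℕ) → 1 < m → ¬ (∀ (x : ℤ) → (+ w a n x) ≡ b [mod m ])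
corollary1p2 1 (ℕ.s≤s ())
corollary1p2 (ℕ.suc (ℕ.suc k)) _ a n nonZero maximal-unique b m 1<m w≡b =
  𝟙-uncancellable 1<m (n t) {{nonZero t}} (a t) Cs Cs-∤-moduli
    (λ y → subst (+ m ∣_) (w-b≡𝟙+⟦⟧ a n t b y) (∣ᵤ⇒∣ (w≡b y)))
  where
  t = argmax n zero (allFin _)
  t-maximal : MaximalModulus n t
  t-maximal = largest⇒maximal nonZero t (All.lookup (f[xs]≤f[argmax] {f = n} zero (allFin _)) ∘ ∈-allFin)
  n[t]∤ : ∀ s → s ≢ t → ¬ n t ℕ.∣ n s
  n[t]∤ s s≢t n[t]∣n[s] = maximal-unique t t-maximal s s≢t (t-maximal s n[t]∣n[s])
  n[t]∤1 : ¬ n t ℕ.∣ 1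
  n[t]∤1 n[t]∣1 = n[t]∤ (punchIn t zero) (punchInᵢ≢i t zero)
    (subst (ℕ._∣ n (punchIn t zero)) (sym (ℕ.∣1⇒≡1 n[t]∣1)) (ℕ.1∣ _))
  Cs = - b ·[ 0ℤ mod 1 ] ∷ tabulate (unitClass a n ∘ punchIn t)
  Cs-∤-moduli : n t ∤-moduli Cs
  Cs-∤-moduli = n[t]∤1 ∷ tabulate⁺ {f = unitClass a n ∘ punchIn t} (λ i → n[t]∤ (punchIn t i) (punchInᵢ≢i t i))
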